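{- Let $k$ and $\ell$ be positive integers. Every rooted graph $(G,\mathcal{Z})$ with a set $Y\subseteq V(G)$ contains either (1) a separation $(A,B)$ of order less than $k(\ell-\|\mathcal{Z}\setminus A\|)$ such that $Y\subseteq V(B)$ and $\|\mathcal{Z}\setminus A\|\le\ell-1$, or (2) a $(\mathcal{Z},Y,k)$-linkage of order $k\ell$.
   Context: All graphs are finite, simple, undirected. A rooted graph $(G,\mathcal{Z})$ is a graph with a finite multiset $\mathcal{Z}=\{Z_1,\dots,Z_m\}$ of subsets of $V(G)$. $\|\mathcal{Z}\|$ is the number of members counted with multiplicity, not counting empty sets. A separation of order $r$ is a pair $(A,B)$ of subgraphs of $G$ with $A\cup B=G$, $E(A)\cap E(B)=\emptyset$, $|V(A)\cap V(B)|=r$; $\mathcal{Z}\setminus A=\{Z_i\setminus V(A):i\in[m]\}$, so $\|\mathcal{Z}\setminus A\|$ is the number of indices $i$ with $Z_i\not\subseteq V(A)$. A vertex set $W$ admits a $(\mathcal{Z},k)$-partition if there are a partition $L_1,\dots,L_x$ of $W$ and an injection $\gamma:[x]\to[m]$ with $|L_i|\le k$ and $L_i\subseteq Z_{\gamma(i)}$. A $(\mathcal{Z},Y,k)$-linkage of order $n$ is a family of $n$ pairwise vertex-disjoint paths $P_1,\dots,P_n$, each from a vertex of $\bigcup_{i}Z_i$ to a vertex of $Y$, such that the set of their end vertices in $\bigcup_i Z_i$ admits a $(\mathcal{Z},k)$-partition. -}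

module Defs where

open import Data.Nat using (ℕ; zero; suc; _+_; _*_; _∸_; _≤_; _<_)
open import Data.Bool using (Bool; true; false)
open import Data.Fin using (Fin)
open import Data.Fin.Subset using (Subset; _∈_; _∉_; _⊆_; _∩_; _∪_; ⋃; ⁅_⁆; ∣_∣; ⊤; Nonempty; Empty)
open import Data.Fin.Subset.Properties using (_⊆?_)
open import Data.List using (List; []; _∷_; length; filter; lookup; map; allFin)
open import Data.List.Membership.Propositional using () renaming (_∈_ to _∈L_)
open import Data.List.Relation.Unary.All using (All)
open import Data.List.Relation.Unary.Unique.Propositional using (Unique)
open import Data.Maybe using (just)
open import Data.Product using (Σ; ∃; _×_; _,_)
open import Data.Sum using (_⊎_)
open import Relation.Nullary using (¬_; ¬?)
open import Relation.Binary.PropositionalEquality using (_≡_; _≢_)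
open import Function.Definitions using (Injective)

record Graph : Set where
  field
    n      : ℕ
    adj    : Fin n → Fin n → Bool
    sym    : ∀ u v → adj u v ≡ adj v u
    irrefl : ∀ v → adj v v ≡ false
open Graph public

V : Graph → Set
V G = Fin (n G)

-- A rooted graph: a graph with a finite multiset Z = {Z_1,...,Z_m} of vertex
-- subsets, represented as a list (multiplicities kept, m = length Z).
Roots : Graph → Set
Roots G = List (Subset (n G))

‖_∖_‖ : ∀ {G : Graph} → Roots G → Subset (n G) → ℕ
‖ Z ∖ VA ‖ = length (filter (λ Zi → ¬? (Zi ⊆? VA)) Z)

-- A separation (A,B): subgraphs A, B of G (vertex sets VA, VB, edge relations
-- EA, EB, stored symmetrically as ordered pairs) with A ∪ B = G and
-- E(A) ∩ E(B) = ∅.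
record Separation (G : Graph) : Set where
  field
    VA VB : Subset (n G)
    EA EB : V G → V G → Bool
    EA-sym : ∀ u v → EA u v ≡ EA v u
    EB-sym : ∀ u v → EB u v ≡ EB v u
    EA-sub : ∀ u v → EA u v ≡ true → adj G u v ≡ true × u ∈ VA × v ∈ VA
    EB-sub : ∀ u v → EB u v ≡ true → adj G u v ≡ true × u ∈ VB × v ∈ VB
    cover-V : ∀ v → v ∈ VA ⊎ v ∈ VB
    cover-E : ∀ u v → adj G u v ≡ true → EA u v ≡ true ⊎ EB u v ≡ true
    disj-E  : ∀ u v → EA u v ≡ true → EB u v ≡ false

order : ∀ {G} → Separation G → ℕ
order S = ∣ Separation.VA S ∩ Separation.VB S ∣

data Walk (G : Graph) : V G → List (V G) → Set where
  single : ∀ v → Walk G v []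
  step   : ∀ {u v vs} → adj G u v ≡ true → Walk G v vs → Walk G u (v ∷ vs)

record Path (G : Graph) : Set where
  field
    start : V G
    rest  : List (V G)
    walk  : Walk G start rest
    distinct : Unique (start ∷ rest)

  verts : List (V G)
  verts = start ∷ rest

  end : V G
  end = lastV start rest
    where
    lastV : V G → List (V G) → V G
    lastV v []       = v
    lastV _ (w ∷ ws) = lastV w ws

AdmitsPartition : ∀ {G : Graph} → Roots G → ℕ → Subset (n G) → Set
AdmitsPartition {G} Z k W =
  Σ ℕ λ x →
  Σ (Fin x → Subset (n G)) λ L →
  Σ (Fin x → Fin (length Z)) λ γ →
    (∀ i → Nonempty (L i)) ×
    (∀ i j → i ≢ j → Empty (L i ∩ L j)) ×
    (∀ v → v ∈ W → ∃ λ i → v ∈ L i) ×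
    (∀ i → L i ⊆ W) ×
    Injective _≡_ _≡_ γ ×
    (∀ i → ∣ L i ∣ ≤ k) ×
    (∀ i → L i ⊆ lookup Z (γ i))

starts : ∀ {G : Graph} {N} → (Fin N → Path G) → Subset (n G)
starts {G} {N} P = ⋃ (map (λ i → ⁅ Path.start (P i) ⁆) (allFin N))

record Linkage (G : Graph) (Z : Roots G) (Y : Subset (n G)) (k N : ℕ) : Set where
  field
    paths    : Fin N → Path G
    disjoint : ∀ i j → i ≢ j → ∀ v →
               _∈L_ v (Path.verts (paths i)) →
               ¬ _∈L_ v (Path.verts (paths j))
    from-Z   : ∀ i → Path.start (paths i) ∈ ⋃ Z
    to-Y     : ∀ i → Path.end (paths i) ∈ Y
    partition : AdmitsPartition {G} Z k (starts {G} {N} paths)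

module Submission where

-- The statement is Menger's theorem in an auxiliary graph H: add to G, for every root set Z_i,
-- k new vertices (copies of Z_i) adjacent to exactly the vertices of Z_i, and separate or link the
-- set of all copies and Y.  Cutting each of kℓ disjoint copy–Y paths in H just after its last copy leaves a
-- (Z,Y,k)-linkage of G: the paths leaving copies of Z_i start in Z_i, and there are at most k of
-- them, which gives the partition.  A separator X of fewer than kℓ vertices in H, with R the side
-- of the copies, gives the separation (R ∪ X, G − R) of G; a root set Z_i not inside V(A) has all
-- its k copies in X, so |V(A) ∩ V(B)| + k‖Z ∖ A‖ ≤ |X| < kℓ.
--
-- Menger's theorem is proved by induction on the edges.  If a separator X (|X| < k) of the smaller
-- graph fails once the edge xy is added, with x on the A-side R and y outside R ∪ X, then X ∪ {x}
-- and X ∪ {y} have at most k vertices.  A small A–(X ∪ {x}) or (X ∪ {y})–B separator of the smaller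
-- graph yields a small A–B separator of the larger one; otherwise the two k-linkages glue, along
-- X and the edge xy, into k disjoint A–B paths.

open import Defs renaming (sym to adj-sym)
open import Data.Nat using (ℕ; zero; suc; _+_; _*_; _∸_; _≤_; _<_; z≤n; s≤s; _<?_)
open import Data.Nat.Properties
  using ( ≤-refl; ≤-trans; <-≤-trans; ≤-<-trans; <-irrefl; ≮⇒≥; n≤1+n; m≤n+m; +-mono-≤; *-suc; *-zeroʳ
        ; *-cancelˡ-<; *-distribˡ-∸; m+n≤o⇒m≤o∸n; <⇒≤pred; pred[m∸n]≡m∸[1+n]; module ≤-Reasoning)
open import Data.Bool using (Bool; true; false; _∧_; _∨_; not)
open import Data.Bool.Properties using (∨-comm) renaming (_≟_ to _≟ᵇ_)
open import Data.Fin using (Fin; zero; suc; inject≤; _↑ˡ_; _↑ʳ_; splitAt; combine; remQuot)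
open import Data.Fin.Properties
  using ( any?; injective⇒≤; inject≤-injective; suc-injective; 0≢1+n; splitAt-↑ˡ; splitAt-↑ʳ
        ; splitAt⁻¹-↑ˡ; splitAt⁻¹-↑ʳ; remQuot-combine; combine-remQuot)
  renaming (_≟_ to _≟ᶠ_)
open import Data.Fin.Subset
  using (Subset; _∈_; _∉_; _⊆_; _∩_; _∪_; _─_; _-_; ∁; ⋃; ⁅_⁆; ∣_∣; ⊤; Nonempty; Empty; inside; outside)
open import Data.Fin.Subset.Properties
  using ( _∈?_; ∉⊥; ∪-identityʳ; ∣⊤∣≡n; p⊆q⇒∣p∣≤∣q∣; x∈⁅x⁆; x∈⁅y⁆⇒x≡y; x∈p∪q⁺; x∈p∪q⁻; x∈p∩q⁺; x∈p∩q⁻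
        ; x∈p∧x∉q⇒x∈p─q; p─q⊆p; x∈p∧x≢y⇒x∈p-y; x∈p⇒∣p-x∣<∣p∣; x∉p⇒x∈∁p; x∈∁p⇒x∉p)
open import Data.Vec using ([]; _∷_; here; there; tabulate; lookup)
open import Data.Vec.Properties using (lookup∘tabulate; tabulate∘lookup; lookup⇒[]=; []=⇒lookup)
open import Data.List as List using (List; []; _∷_; _++_; length; map; filter; allFin; cartesianProduct)
open import Data.List.Membership.Propositional using () renaming (_∈_ to _∈ˡ_; _∉_ to _∉ˡ_)
open import Data.List.Membership.Propositional.Properties
  using (∈-++⁻; ∈-map⁺; ∈-map⁻; ∈-filter⁺; ∈-filter⁻; ∈-allFin; ∈-cartesianProduct⁺; ∈-lookup)
open import Data.List.Relation.Binary.Subset.Propositional using () renaming (_⊆_ to _⊆ˡ_)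
open import Data.List.Relation.Unary.Any using (here; there)
open import Data.List.Relation.Unary.All using ([]; _∷_) renaming (tabulate to tabulateᴬ; lookup to lookupᴬ)
open import Data.List.Relation.Unary.AllPairs using ([]; _∷_)
import Data.List.Relation.Unary.AllPairs as AllPairs
open import Data.List.Relation.Unary.Unique.Propositional using (Unique)
import Data.List.Relation.Unary.Unique.Propositional.Properties as Unique
open import Data.Product using (Σ; ∃; ∃₂; _×_; _,_; proj₁; proj₂)
open import Data.Sum using (_⊎_; inj₁; inj₂)
import Data.Sum as Sum
open import Function using (_∘_)
open import Function.Definitions using (Injective)
open import Level using (0ℓ)
open import Relation.Unary using (Pred; Decidable)
open import Relation.Nullary using (¬_; Dec; yes; no; does; contradiction; _×-dec_)
open import Relation.Nullary.Decidable using (dec-true)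
open import Relation.Binary.PropositionalEquality using (_≡_; _≢_; refl; sym; trans; cong; cong₂; subst; subst₂)

private variable
  N k : ℕ

x∈p─q⇒x∉q : ∀ {p q : Subset N} {x} → x ∈ p ─ q → x ∉ q
x∈p─q⇒x∉q {p = _ ∷ _} {inside  ∷ _} (there x∈) (there x∈q) = x∈p─q⇒x∉q x∈ x∈q
x∈p─q⇒x∉q {p = _ ∷ _} {outside ∷ _} (there x∈) (there x∈q) = x∈p─q⇒x∉q x∈ x∈q

∣p∪⁅x⁆∣≤1+∣p∣ : ∀ (p : Subset N) x → ∣ p ∪ ⁅ x ⁆ ∣ ≤ suc ∣ p ∣
∣p∪⁅x⁆∣≤1+∣p∣ (inside  ∷ p) zero    = s≤s (subst (λ q → ∣ q ∣ ≤ suc ∣ p ∣) (sym (∪-identityʳ p)) (n≤1+n _))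
∣p∪⁅x⁆∣≤1+∣p∣ (outside ∷ p) zero    = s≤s (subst (λ q → ∣ q ∣ ≤ ∣ p ∣) (sym (∪-identityʳ p)) ≤-refl)
∣p∪⁅x⁆∣≤1+∣p∣ (inside  ∷ p) (suc x) = s≤s (∣p∪⁅x⁆∣≤1+∣p∣ p x)
∣p∪⁅x⁆∣≤1+∣p∣ (outside ∷ p) (suc x) = ∣p∪⁅x⁆∣≤1+∣p∣ p x

∈-tabulate⁺ : ∀ {f : Fin N → Bool} {x} → f x ≡ true → x ∈ tabulate f
∈-tabulate⁺ {f = f} {x} fx = lookup⇒[]= x (tabulate f) (trans (lookup∘tabulate f x) fx)

∈-tabulate⁻ : ∀ {f : Fin N → Bool} {x} → x ∈ tabulate f → f x ≡ true
∈-tabulate⁻ {f = f} {x} x∈ = trans (sym (lookup∘tabulate f x)) ([]=⇒lookup x∈)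

subsetOf : ∀ {P : Pred (Fin N) 0ℓ} → Decidable P → Subset N
subsetOf P? = tabulate (does ∘ P?)

∈-subsetOf⁺ : ∀ {P : Pred (Fin N) 0ℓ} (P? : Decidable P) {x} → P x → x ∈ subsetOf P?
∈-subsetOf⁺ P? Px = ∈-tabulate⁺ (dec-true (P? _) Px)

∈-subsetOf⁻ : ∀ {P : Pred (Fin N) 0ℓ} (P? : Decidable P) {x} → x ∈ subsetOf P? → P x
∈-subsetOf⁻ P? {x} x∈ = witness (P? x) (∈-tabulate⁻ {f = does ∘ P?} x∈)
  where
  witness : ∀ {A : Set} (a? : Dec A) → does a? ≡ true → A
  witness (yes a) _ = a

injective⇒≤∣p∣ : ∀ {p : Subset N} (g : Fin k → Fin N) → Injective _≡_ _≡_ g → (∀ i → g i ∈ p) → k ≤ ∣ p ∣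
injective⇒≤∣p∣ {k = zero}  g g-inj g∈p = z≤n
injective⇒≤∣p∣ {k = suc k} {p = p} g g-inj g∈p =
  <-≤-trans (s≤s (injective⇒≤∣p∣ (g ∘ suc) (suc-injective ∘ g-inj) g∘suc∈p-g0))
            (x∈p⇒∣p-x∣<∣p∣ (g∈p zero))
  where
  g∘suc∈p-g0 : ∀ i → g (suc i) ∈ p - g zero
  g∘suc∈p-g0 i = x∈p∧x≢y⇒x∈p-y (g∈p (suc i)) (λ eq → 0≢1+n (sym (g-inj eq)))

Enumeration : Subset N → ℕ → Set
Enumeration {N} p k = Σ (Fin k → Fin N) λ g → Injective _≡_ _≡_ g × (∀ i → g i ∈ p)

enumerate : (p : Subset N) → Enumeration p ∣ p ∣
enumerate []            = (λ ()) , (λ {}) , (λ ())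
enumerate (outside ∷ p) with enumerate p
... | g , g-inj , g∈p = suc ∘ g , g-inj ∘ suc-injective , there ∘ g∈p
enumerate (inside ∷ p) with enumerate p
... | g , g-inj , g∈p = g′ , g′-inj , g′∈p
  where
  g′ : Fin (suc ∣ p ∣) → Fin _
  g′ zero    = zero
  g′ (suc i) = suc (g i)
  g′-inj : Injective _≡_ _≡_ g′
  g′-inj {zero}  {zero}  _  = refl
  g′-inj {suc i} {suc j} eq = cong suc (g-inj (suc-injective eq))
  g′∈p : ∀ i → g′ i ∈ inside ∷ p
  g′∈p zero    = here
  g′∈p (suc i) = there (g∈p i)

enumerate≤ : (p : Subset N) → k ≤ ∣ p ∣ → Enumeration p k
enumerate≤ p k≤ with enumerate p
... | g , g-inj , g∈p =
  (λ i → g (inject≤ i k≤)) , (λ eq → inject≤-injective k≤ k≤ _ _ (g-inj eq)) , (λ i → g∈p (inject≤ i k≤))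

enumeration-surjective : ∀ {p : Subset N} ((g , _ , _) : Enumeration p k) → ∣ p ∣ ≤ k →
                         ∀ {x} → x ∈ p → ∃ λ i → g i ≡ x
enumeration-surjective {k = k} {p = p} (g , g-inj , g∈p) ∣p∣≤k {x} x∈p with any? (λ i → g i ≟ᶠ x)
... | yes hit = hit
... | no miss = contradiction
  (≤-<-trans (injective⇒≤∣p∣ g g-inj g∈p-x) (<-≤-trans (x∈p⇒∣p-x∣<∣p∣ x∈p) ∣p∣≤k)) (<-irrefl refl)
  where
  g∈p-x : ∀ i → g i ∈ p - x
  g∈p-x i = x∈p∧x≢y⇒x∈p-y (g∈p i) (λ eq → miss (i , eq))

∣p∣≤k-by-labels : ∀ {p : Subset N} (label : ∀ {x} → x ∈ p → Fin k) →
                  (∀ {x y} (x∈p : x ∈ p) (y∈p : y ∈ p) → label x∈p ≡ label y∈p → x ≡ y) → ∣ p ∣ ≤ k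
∣p∣≤k-by-labels {p = p} label label-inj with enumerate p
... | g , g-inj , g∈p = injective⇒≤ (λ eq → g-inj (label-inj (g∈p _) (g∈p _) eq))

x∈⋃⁺ : ∀ {ps : List (Subset N)} {p x} → p ∈ˡ ps → x ∈ p → x ∈ ⋃ ps
x∈⋃⁺ (here refl) x∈p = x∈p∪q⁺ (inj₁ x∈p)
x∈⋃⁺ (there p∈)  x∈p = x∈p∪q⁺ (inj₂ (x∈⋃⁺ p∈ x∈p))

x∈⋃⁻ : ∀ (ps : List (Subset N)) {x} → x ∈ ⋃ ps → ∃ λ p → p ∈ˡ ps × x ∈ p
x∈⋃⁻ List.[]       x∈ = contradiction x∈ ∉⊥
x∈⋃⁻ (p List.∷ ps) x∈ with x∈p∪q⁻ p (⋃ ps) x∈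
... | inj₁ x∈p = p , here refl , x∈p
... | inj₂ x∈⋃ with x∈⋃⁻ ps x∈⋃
...   | q , q∈ , x∈q = q , there q∈ , x∈q

pullback : ∀ {M} → (Fin M → Fin N) → Subset N → Subset M
pullback f p = tabulate (λ x → lookup p (f x))

∈-pullback⁺ : ∀ {M} {f : Fin M → Fin N} {p x} → f x ∈ p → x ∈ pullback f p
∈-pullback⁺ {f = f} {p} fx∈p = ∈-tabulate⁺ ([]=⇒lookup fx∈p)

∈-pullback⁻ : ∀ {M} {f : Fin M → Fin N} {p x} → x ∈ pullback f p → f x ∈ p
∈-pullback⁻ {f = f} {p} {x} x∈ = lookup⇒[]= (f x) p (∈-tabulate⁻ x∈)

∣p∣≡∣↑ˡ∣+∣↑ʳ∣ : ∀ a b (p : Subset (a + b)) → ∣ p ∣ ≡ ∣ pullback (_↑ˡ b) p ∣ + ∣ pullback (a ↑ʳ_) p ∣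
∣p∣≡∣↑ˡ∣+∣↑ʳ∣ zero    b p             = cong ∣_∣ (sym (tabulate∘lookup p))
∣p∣≡∣↑ˡ∣+∣↑ʳ∣ (suc a) b (inside  ∷ p) = cong suc (∣p∣≡∣↑ˡ∣+∣↑ʳ∣ a b p)
∣p∣≡∣↑ˡ∣+∣↑ʳ∣ (suc a) b (outside ∷ p) = ∣p∣≡∣↑ˡ∣+∣↑ʳ∣ a b p

full-blocks≤∣p∣ : ∀ {a} {A : Set a} {P : Pred A a} (P? : Decidable P) (xs : List A) (p : Subset (length xs * k)) →
                  (∀ i c → P (List.lookup xs i) → combine i c ∈ p) → k * length (filter P? xs) ≤ ∣ p ∣
full-blocks≤∣p∣ {k = k} P? List.[] [] full = subst (_≤ 0) (sym (*-zeroʳ k)) z≤n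
full-blocks≤∣p∣ {k = k} P? (x List.∷ xs) p full with P? x
... | yes Px = begin
  k * suc (length (filter P? xs))  ≡⟨ *-suc k _ ⟩
  k + k * length (filter P? xs)    ≤⟨ +-mono-≤ first-block later-blocks ⟩
  ∣ first ∣ + ∣ later ∣            ≡⟨ ∣p∣≡∣↑ˡ∣+∣↑ʳ∣ k (length xs * k) p ⟨
  ∣ p ∣                            ∎
  where
  open ≤-Reasoning
  first = pullback (_↑ˡ (length xs * k)) p
  later = pullback (k ↑ʳ_) p
  first-block : k ≤ ∣ first ∣
  first-block = subst (_≤ ∣ first ∣) (∣⊤∣≡n k) (p⊆q⇒∣p∣≤∣q∣ {p = ⊤} (λ {c} _ → ∈-pullback⁺ (full zero c Px)))
  later-blocks : k * length (filter P? xs) ≤ ∣ later ∣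
  later-blocks = full-blocks≤∣p∣ P? xs later (λ i c Pxi → ∈-pullback⁺ (full (suc i) c Pxi))
... | no _ = begin
  k * length (filter P? xs)        ≤⟨ full-blocks≤∣p∣ P? xs later (λ i c Pxi → ∈-pullback⁺ (full (suc i) c Pxi)) ⟩
  ∣ later ∣                        ≤⟨ m≤n+m _ _ ⟩
  ∣ first ∣ + ∣ later ∣            ≡⟨ ∣p∣≡∣↑ˡ∣+∣↑ʳ∣ k (length xs * k) p ⟨
  ∣ p ∣                            ∎
  where
  open ≤-Reasoning
  first = pullback (_↑ˡ (length xs * k)) p
  later = pullback (k ↑ʳ_) p

last : ∀ {A : Set} → A → List A → A
last v []       = v
last _ (w ∷ ws) = last w ws

last∈ : ∀ {A : Set} (v : A) vs → last v vs ∈ˡ v ∷ vs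
last∈ v []       = here refl
last∈ v (w ∷ ws) = there (last∈ w ws)

last-++ : ∀ {A : Set} (v : A) vs ws → last v (vs ++ ws) ≡ last (last v vs) ws
last-++ v []       ws = refl
last-++ v (w ∷ vs) ws = last-++ w vs ws

last-map : ∀ {A B : Set} (f : A → B) v vs → f (last v vs) ≡ last (f v) (map f vs)
last-map f v []       = refl
last-map f v (w ∷ ws) = last-map f w ws

-- Menger's theorem for graphs given by edge lists

module Menger (N : ℕ) where

  Vertex : Set
  Vertex = Fin N

  Edges : Set
  Edges = List (Vertex × Vertex)

  Adj : Edges → Vertex → Vertex → Set
  Adj E u v = (u , v) ∈ˡ E ⊎ (v , u) ∈ˡ E

  _⊆ᴬ_ : Edges → Edges → Set
  E ⊆ᴬ E′ = ∀ {u v} → Adj E u v → Adj E′ u v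

  adj-∷⁺ : ∀ {e E} → E ⊆ᴬ (e ∷ E)
  adj-∷⁺ = Sum.map there there

  adj-∷⁻ : ∀ {x y E u v} → Adj ((x , y) ∷ E) u v → (u ≡ x × v ≡ y) ⊎ (u ≡ y × v ≡ x) ⊎ Adj E u v
  adj-∷⁻ (inj₁ (here refl)) = inj₁ (refl , refl)
  adj-∷⁻ (inj₂ (here refl)) = inj₂ (inj₁ (refl , refl))
  adj-∷⁻ (inj₁ (there e))   = inj₂ (inj₂ (inj₁ e))
  adj-∷⁻ (inj₂ (there e))   = inj₂ (inj₂ (inj₂ e))

  adj-swap : ∀ {x y E} → ((x , y) ∷ E) ⊆ᴬ ((y , x) ∷ E)
  adj-swap (inj₁ (here refl)) = inj₂ (here refl)
  adj-swap (inj₂ (here refl)) = inj₁ (here refl)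
  adj-swap (inj₁ (there e))   = inj₁ (there e)
  adj-swap (inj₂ (there e))   = inj₂ (there e)

  private variable
    E E′ : Edges
    A B : Subset N
    u v a : Vertex
    vs ws : List Vertex

  data EWalk (E : Edges) : Vertex → List Vertex → Set where
    nil  : EWalk E v []
    cons : Adj E u v → EWalk E v vs → EWalk E u (v ∷ vs)

  map-walk : E ⊆ᴬ E′ → EWalk E v vs → EWalk E′ v vs
  map-walk f nil        = nil
  map-walk f (cons e w) = cons (f e) (map-walk f w)

  ++-walk : EWalk E v vs → EWalk E (last v vs) ws → EWalk E v (vs ++ ws)
  ++-walk nil        w′ = w′
  ++-walk (cons e w) w′ = cons e (++-walk w w′)

  record EPath (E : Edges) : Set where
    constructor epath
    field
      start  : Vertex
      rest   : List Vertex
      walk   : EWalk E start rest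
      unique : Unique (start ∷ rest)

    verts : List Vertex
    verts = start ∷ rest

    end : Vertex
    end = last start rest

  open EPath using (start; verts; end)

  map-path : E ⊆ᴬ E′ → EPath E → EPath E′
  map-path f (epath s r w u) = epath s r (map-walk f w) u

  record ABLinkage (E : Edges) (A B : Subset N) (k : ℕ) : Set where
    field
      paths    : Fin k → EPath E
      disjoint : ∀ i j → i ≢ j → ∀ v → v ∈ˡ verts (paths i) → v ∉ˡ verts (paths j)
      start∈A  : ∀ i → start (paths i) ∈ A
      end∈B    : ∀ i → end (paths i) ∈ B

    on-paths-injective : (f : Fin k → Vertex) → (∀ i → f i ∈ˡ verts (paths i)) → Injective _≡_ _≡_ f
    on-paths-injective f f∈ {i} {j} eq with i ≟ᶠ j
    ... | yes i≡j = i≡j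
    ... | no  i≢j = contradiction (subst (_∈ˡ verts (paths j)) (sym eq) (f∈ j)) (disjoint i j i≢j (f i) (f∈ i))

  map-linkage : E ⊆ᴬ E′ → ABLinkage E A B k → ABLinkage E′ A B k
  map-linkage f L = record
    { paths = map-path f ∘ paths ; disjoint = disjoint ; start∈A = start∈A ; end∈B = end∈B }
    where open ABLinkage L

  Closed : Edges → Subset N → Subset N → Set
  Closed E R X = ∀ {u v} → Adj E u v → u ∈ R → v ∈ R ⊎ v ∈ X

  -- X separates A from B: no walk from A can leave the region R without passing through X.
  record ABSeparator (E : Edges) (A B : Subset N) (k : ℕ) : Set where
    field
      R X    : Subset N
      A⊆R∪X  : ∀ {v} → v ∈ A → v ∈ R ⊎ v ∈ X
      B∩R≡∅  : ∀ {v} → v ∈ B → v ∉ R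
      closed : Closed E R X
      ∣X∣<k  : ∣ X ∣ < k

  comap-separator : E′ ⊆ᴬ E → ABSeparator E A B k → ABSeparator E′ A B k
  comap-separator f S = record
    { R = R ; X = X ; A⊆R∪X = A⊆R∪X ; B∩R≡∅ = B∩R≡∅ ; closed = closed ∘ f ; ∣X∣<k = ∣X∣<k }
    where open ABSeparator S

  data InitAvoids (X : Subset N) : Vertex → List Vertex → Set where
    []  : InitAvoids X v []
    _∷_ : v ∉ X → InitAvoids X u vs → InitAvoids X v (u ∷ vs)

  record PrefixTo (E : Edges) (X : Subset N) (v : Vertex) (vs : List Vertex) : Set where
    field
      rest   : List Vertex
      walk   : EWalk E v rest
      unique : Unique (v ∷ rest)
      end∈X  : last v rest ∈ X
      avoids : InitAvoids X v rest
      ⊆path  : v ∷ rest ⊆ˡ v ∷ vs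

  prefix-to : ∀ X → EWalk E v vs → Unique (v ∷ vs) → last v vs ∈ X → PrefixTo E X v vs
  prefix-to {v = v} X w u end∈X with v ∈? X
  ... | yes v∈X = record
    { rest = [] ; walk = nil ; unique = [] ∷ [] ; end∈X = v∈X ; avoids = [] ; ⊆path = λ { (here eq) → here eq } }
  prefix-to X nil        _           end∈X | no v∉X = contradiction end∈X v∉X
  prefix-to X (cons e w) (v∉vs ∷ u) end∈X | no v∉X = record
    { rest   = _ ∷ rest
    ; walk   = cons e walk
    ; unique = tabulateᴬ (λ m → lookupᴬ v∉vs (⊆path m)) ∷ unique
    ; end∈X  = end∈X′
    ; avoids = v∉X ∷ avoids
    ; ⊆path  = λ { (here eq) → here eq ; (there m) → there (⊆path m) }
    }
    where open PrefixTo (prefix-to X w u end∈X) renaming (end∈X to end∈X′)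

  record SuffixFrom (E : Edges) (X : Subset N) (v : Vertex) (vs : List Vertex) : Set where
    constructor suffix
    field
      first    : Vertex
      rest     : List Vertex
      walk     : EWalk E first rest
      unique   : Unique (first ∷ rest)
      first∈X  : first ∈ X
      rest∉X   : ∀ {u} → u ∈ˡ rest → u ∉ X
      same-end : last first rest ≡ last v vs
      ⊆path    : first ∷ rest ⊆ˡ v ∷ vs

  last-entry : ∀ X → EWalk E v vs → Unique (v ∷ vs) → SuffixFrom E X v vs ⊎ (∀ {u} → u ∈ˡ v ∷ vs → u ∉ X)
  last-entry {v = v} X nil u with v ∈? X
  ... | yes v∈X = inj₁ (suffix v [] nil u v∈X (λ ()) refl (λ m → m))
  ... | no  v∉X = inj₂ λ { (here refl) → v∉X }
  last-entry {v = v} X (cons e w) (v∉vs ∷ u) with last-entry X w u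
  ... | inj₁ (suffix f r w′ u′ f∈X r∉X same ⊆p) = inj₁ (suffix f r w′ u′ f∈X r∉X same (there ∘ ⊆p))
  ... | inj₂ none with v ∈? X
  ...   | yes v∈X = inj₁ (suffix v _ (cons e w) (v∉vs ∷ u) v∈X none refl (λ m → m))
  ...   | no  v∉X = inj₂ λ { (here refl) → v∉X ; (there m) → none m }

  suffix-from : ∀ X → EWalk E v vs → Unique (v ∷ vs) → v ∈ X → SuffixFrom E X v vs
  suffix-from X w u v∈X with last-entry X w u
  ... | inj₁ s    = s
  ... | inj₂ none = contradiction v∈X (none (here refl))

  module _ {R X : Subset N} (closed : Closed E R X) where

    walk-within : EWalk E a vs → InitAvoids X a vs → a ∈ R ⊎ a ∈ X →
                  ∀ {u} → u ∈ˡ a ∷ vs → u ∈ R ⊎ u ≡ last a vs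
    walk-within nil        []           _         (here refl) = inj₂ refl
    walk-within (cons e w) (a∉X ∷ avoid) (inj₂ a∈X) _           = contradiction a∈X a∉X
    walk-within (cons e w) (a∉X ∷ avoid) (inj₁ a∈R) (here refl) = inj₁ a∈R
    walk-within (cons e w) (a∉X ∷ avoid) (inj₁ a∈R) (there m)   = walk-within w avoid (closed e a∈R) m

    walk-stays-in : EWalk E a vs → a ∈ R → (∀ {u} → u ∈ˡ vs → u ∉ X) → last a vs ∈ R
    walk-stays-in nil        a∈R _   = a∈R
    walk-stays-in (cons e w) a∈R ∉X with closed e a∈R
    ... | inj₁ b∈R = walk-stays-in w b∈R (∉X ∘ there)
    ... | inj₂ b∈X = contradiction b∈X (∉X (here refl))

    walk-avoids : EWalk E a vs → (∀ {u} → u ∈ˡ vs → u ∉ X) → last a vs ∉ R → ∀ {u} → u ∈ˡ vs → u ∉ R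
    walk-avoids (cons e w) ∉X end∉R (here refl) b∈R = end∉R (walk-stays-in w b∈R (∉X ∘ there))
    walk-avoids (cons e w) ∉X end∉R (there m)       = walk-avoids w (∉X ∘ there) end∉R m

  module MengerStep {E : Edges} {x y : Vertex} {A B : Subset N} {k : ℕ} (S : ABSeparator E A B k)
                    (x∈R : x ∈ ABSeparator.R S) (y∉R : y ∉ ABSeparator.R S) (y∉X : y ∉ ABSeparator.X S) where

    open ABSeparator S

    E⁺ : Edges
    E⁺ = (x , y) ∷ E

    X₁ X₂ : Subset N
    X₁ = X ∪ ⁅ x ⁆
    X₂ = X ∪ ⁅ y ⁆

    X⊆X∪⁅_⁆ : ∀ z {v} → v ∈ X → v ∈ X ∪ ⁅ z ⁆
    X⊆X∪⁅ z ⁆ v∈X = x∈p∪q⁺ (inj₁ v∈X)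

    z∈X∪⁅z⁆ : ∀ z → z ∈ X ∪ ⁅ z ⁆
    z∈X∪⁅z⁆ z = x∈p∪q⁺ (inj₂ (x∈⁅x⁆ z))

    separator-to-X₁ : ABSeparator E A X₁ k → ABSeparator E⁺ A B k
    separator-to-X₁ S₁ = record
      { R = S₁.R ∩ R ; X = S₁.X ; A⊆R∪X = A⊆R∪X′ ; B∩R≡∅ = λ v∈B v∈R → B∩R≡∅ v∈B (proj₂ (x∈p∩q⁻ _ _ v∈R))
      ; closed = closed′ ; ∣X∣<k = S₁.∣X∣<k }
      where
      module S₁ = ABSeparator S₁
      both : ∀ {v} → v ∈ S₁.R → v ∈ R ⊎ v ∈ X → v ∈ S₁.R ∩ R ⊎ v ∈ S₁.X
      both v∈R₁ (inj₁ v∈R) = inj₁ (x∈p∩q⁺ (v∈R₁ , v∈R))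
      both v∈R₁ (inj₂ v∈X) = contradiction v∈R₁ (S₁.B∩R≡∅ (X⊆X∪⁅ x ⁆ v∈X))
      A⊆R∪X′ : ∀ {v} → v ∈ A → v ∈ S₁.R ∩ R ⊎ v ∈ S₁.X
      A⊆R∪X′ v∈A with S₁.A⊆R∪X v∈A
      ... | inj₁ v∈R₁ = both v∈R₁ (A⊆R∪X v∈A)
      ... | inj₂ v∈X₁ = inj₂ v∈X₁
      closed′ : Closed E⁺ (S₁.R ∩ R) S₁.X
      closed′ e u∈ with x∈p∩q⁻ _ _ u∈ | adj-∷⁻ e
      ... | u∈R₁ , _   | inj₁ (refl , refl)        = contradiction u∈R₁ (S₁.B∩R≡∅ (z∈X∪⁅z⁆ x))
      ... | _    , u∈R | inj₂ (inj₁ (refl , refl)) = contradiction u∈R y∉R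
      ... | u∈R₁ , u∈R | inj₂ (inj₂ e′) with S₁.closed e′ u∈R₁
      ...   | inj₁ v∈R₁ = both v∈R₁ (closed e′ u∈R)
      ...   | inj₂ v∈X₁ = inj₂ v∈X₁

    separator-from-X₂ : ABSeparator E X₂ B k → ABSeparator E⁺ A B k
    separator-from-X₂ S₂ = record
      { R = (R ∪ S₂.R) ─ S₂.X ; X = S₂.X ; A⊆R∪X = A⊆R∪X′ ; B∩R≡∅ = B∩R≡∅′
      ; closed = closed′ ; ∣X∣<k = S₂.∣X∣<k }
      where
      module S₂ = ABSeparator S₂
      X₂⊆R₂ : ∀ {v} → v ∈ X₂ → v ∉ S₂.X → v ∈ S₂.R
      X₂⊆R₂ v∈X₂ v∉T with S₂.A⊆R∪X v∈X₂
      ... | inj₁ v∈R₂ = v∈R₂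
      ... | inj₂ v∈T  = contradiction v∈T v∉T
      R∪X⊆R∪R₂ : ∀ {v} → v ∈ R ⊎ v ∈ X → v ∉ S₂.X → v ∈ R ∪ S₂.R
      R∪X⊆R∪R₂ (inj₁ v∈R) _   = x∈p∪q⁺ (inj₁ v∈R)
      R∪X⊆R∪R₂ (inj₂ v∈X) v∉T = x∈p∪q⁺ (inj₂ (X₂⊆R₂ (X⊆X∪⁅ y ⁆ v∈X) v∉T))
      unless-in-T : ∀ {v} → (v ∉ S₂.X → v ∈ R ∪ S₂.R) → v ∈ (R ∪ S₂.R) ─ S₂.X ⊎ v ∈ S₂.X
      unless-in-T {v} v∈ with v ∈? S₂.X
      ... | yes v∈T = inj₂ v∈T
      ... | no  v∉T = inj₁ (x∈p∧x∉q⇒x∈p─q (v∈ v∉T) v∉T)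
      A⊆R∪X′ : ∀ {v} → v ∈ A → v ∈ (R ∪ S₂.R) ─ S₂.X ⊎ v ∈ S₂.X
      A⊆R∪X′ v∈A = unless-in-T (R∪X⊆R∪R₂ (A⊆R∪X v∈A))
      B∩R≡∅′ : ∀ {v} → v ∈ B → v ∉ (R ∪ S₂.R) ─ S₂.X
      B∩R≡∅′ v∈B v∈ with x∈p∪q⁻ _ _ (p─q⊆p _ _ v∈)
      ... | inj₁ v∈R  = B∩R≡∅ v∈B v∈R
      ... | inj₂ v∈R₂ = S₂.B∩R≡∅ v∈B v∈R₂
      closed′ : Closed E⁺ ((R ∪ S₂.R) ─ S₂.X) S₂.X
      closed′ e u∈ = unless-in-T (successor-in (adj-∷⁻ e) (x∈p∪q⁻ _ _ (p─q⊆p _ _ u∈)))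
        where
        successor-in : ∀ {u v} → (u ≡ x × v ≡ y) ⊎ (u ≡ y × v ≡ x) ⊎ Adj E u v →
                       u ∈ R ⊎ u ∈ S₂.R → v ∉ S₂.X → v ∈ R ∪ S₂.R
        successor-in (inj₁ (refl , refl))        _           v∉T = x∈p∪q⁺ (inj₂ (X₂⊆R₂ (z∈X∪⁅z⁆ y) v∉T))
        successor-in (inj₂ (inj₁ (refl , refl))) _           _   = x∈p∪q⁺ (inj₁ x∈R)
        successor-in (inj₂ (inj₂ e′))           (inj₁ u∈R)  v∉T = R∪X⊆R∪R₂ (closed e′ u∈R) v∉T
        successor-in (inj₂ (inj₂ e′))           (inj₂ u∈R₂) v∉T with S₂.closed e′ u∈R₂
        ... | inj₁ v∈R₂ = x∈p∪q⁺ (inj₂ v∈R₂)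
        ... | inj₂ v∈T  = contradiction v∈T v∉T

    ∣X₂∣≤k : ∣ X₂ ∣ ≤ k
    ∣X₂∣≤k = ≤-trans (∣p∪⁅x⁆∣≤1+∣p∣ X y) ∣X∣<k

    closed-X₁ : Closed E R X₁
    closed-X₁ e u∈R = Sum.map₂ X⊆X∪⁅ x ⁆ (closed e u∈R)

    module Splice (L₁ : ABLinkage E A X₁ k) (L₂ : ABLinkage E X₂ B k) where
      module L₁ = ABLinkage L₁
      module L₂ = ABLinkage L₂

      P Q : Fin k → EPath E
      P = L₁.paths
      Q = L₂.paths

      to-X₁ : ∀ i → PrefixTo E X₁ (start (P i)) (EPath.rest (P i))
      to-X₁ i = prefix-to X₁ (EPath.walk (P i)) (EPath.unique (P i)) (L₁.end∈B i)

      from-X₂ : ∀ j → SuffixFrom E X₂ (start (Q j)) (EPath.rest (Q j))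
      from-X₂ j = suffix-from X₂ (EPath.walk (Q j)) (EPath.unique (Q j)) (L₂.start∈A j)

      exit : Fin k → Vertex
      exit i = last (start (P i)) (PrefixTo.rest (to-X₁ i))

      entry : Fin k → Vertex
      entry j = SuffixFrom.first (from-X₂ j)

      exit-injective : Injective _≡_ _≡_ exit
      exit-injective = L₁.on-paths-injective exit (λ i → PrefixTo.⊆path (to-X₁ i) (last∈ _ _))

      entry-injective : Injective _≡_ _≡_ entry
      entry-injective = L₂.on-paths-injective entry (λ j → SuffixFrom.⊆path (from-X₂ j) (here refl))

      entering : ∀ {v} → v ∈ X₂ → ∃ λ j → entry j ≡ v
      entering = enumeration-surjective (entry , entry-injective , SuffixFrom.first∈X ∘ from-X₂) ∣X₂∣≤k

      exit∈X : ∀ {i} → exit i ≢ x → exit i ∈ X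
      exit∈X {i} exit≢x with x∈p∪q⁻ _ _ (PrefixTo.end∈X (to-X₁ i))
      ... | inj₁ exit∈X = exit∈X
      ... | inj₂ exit∈x = contradiction (x∈⁅y⁆⇒x≡y x exit∈x) exit≢x

      head-inside : ∀ i {u} → u ∈ˡ start (P i) ∷ PrefixTo.rest (to-X₁ i) → u ∈ R ⊎ u ∈ X
      head-inside i u∈ with walk-within closed-X₁ walk avoids (Sum.map₂ X⊆X∪⁅ x ⁆ (A⊆R∪X (L₁.start∈A i))) u∈
        where open PrefixTo (to-X₁ i)
      ... | inj₁ u∈R = inj₁ u∈R
      ... | inj₂ refl with exit i ≟ᶠ x
      ...   | yes exit≡x = inj₁ (subst (_∈ R) (sym exit≡x) x∈R)
      ...   | no  exit≢x = inj₂ (exit∈X exit≢x)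

      tail-outside : ∀ j {u} → u ∈ˡ SuffixFrom.rest (from-X₂ j) → u ∉ R × u ∉ X
      tail-outside j u∈ = walk-avoids closed walk (λ m → rest∉X m ∘ X⊆X∪⁅ y ⁆) end∉R u∈ , rest∉X u∈ ∘ X⊆X∪⁅ y ⁆
        where
        open SuffixFrom (from-X₂ j)
        end∉R : last first rest ∉ R
        end∉R = B∩R≡∅ (subst (_∈ B) (sym same-end) (L₂.end∈B j))

      -- The rest of the i-th spliced path: a tail of the j-th path of L₂, entered through the edge xy
      -- when the i-th path of L₁ exits through x.
      record Continuation (i : Fin k) : Set where
        field
          j       : Fin k
          route   : List Vertex
          walk    : EWalk E⁺ (exit i) route
          unique  : Unique route
          end∈B   : last (exit i) route ∈ B
          ⊆Q      : route ⊆ˡ verts (Q j)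
          ∉R∪X    : ∀ {u} → u ∈ˡ route → u ∉ R × u ∉ X
          via     : (exit i ≡ x × entry j ≡ y) ⊎ (exit i ∈ X × entry j ≡ exit i)

      continue : ∀ i → Continuation i
      continue i with exit i ≟ᶠ x
      ... | yes exit≡x with entering (z∈X∪⁅z⁆ y)
      ...   | j , entry≡y = record
        { j       = j
        ; route   = first ∷ rest
        ; walk    = cons (subst₂ (Adj E⁺) (sym exit≡x) (sym entry≡y) (inj₁ (here refl))) (map-walk adj-∷⁺ walk)
        ; unique  = unique
        ; end∈B   = subst (_∈ B) (sym same-end) (L₂.end∈B j)
        ; ⊆Q      = ⊆path
        ; ∉R∪X    = λ { (here refl) → subst (_∉ R) (sym entry≡y) y∉R , subst (_∉ X) (sym entry≡y) y∉X
                      ; (there m) → tail-outside j m }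
        ; via     = inj₁ (exit≡x , entry≡y)
        }
        where open SuffixFrom (from-X₂ j)
      continue i | no exit≢x with entering (X⊆X∪⁅ y ⁆ (exit∈X exit≢x))
      ...   | j , entry≡exit = record
        { j       = j
        ; route   = rest
        ; walk    = subst (λ z → EWalk E⁺ z rest) entry≡exit (map-walk adj-∷⁺ walk)
        ; unique  = AllPairs.tail unique
        ; end∈B   = subst (λ z → last z rest ∈ B) entry≡exit (subst (_∈ B) (sym same-end) (L₂.end∈B j))
        ; ⊆Q      = ⊆path ∘ there
        ; ∉R∪X    = tail-outside j
        ; via     = inj₂ (exit∈X exit≢x , entry≡exit)
        }
        where open SuffixFrom (from-X₂ j)

      continuation-injective : Injective _≡_ _≡_ (Continuation.j ∘ continue)
      continuation-injective {i} {i′} eq =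
        exit-injective (same-exit (Continuation.via (continue i)) (Continuation.via (continue i′)))
        where
        j = Continuation.j (continue i)
        j′ = Continuation.j (continue i′)
        entry≡ : entry j ≡ entry j′
        entry≡ = cong entry eq
        same-exit : (exit i ≡ x × entry j ≡ y) ⊎ (exit i ∈ X × entry j ≡ exit i) →
                    (exit i′ ≡ x × entry j′ ≡ y) ⊎ (exit i′ ∈ X × entry j′ ≡ exit i′) → exit i ≡ exit i′
        same-exit (inj₁ (≡x , _)) (inj₁ (≡x′ , _)) = trans ≡x (sym ≡x′)
        same-exit (inj₁ (_ , ≡y)) (inj₂ (∈X , ≡e)) =
          contradiction (subst (_∈ X) (trans (sym ≡e) (trans (sym entry≡) ≡y)) ∈X) y∉X
        same-exit (inj₂ (∈X , ≡e)) (inj₁ (_ , ≡y)) =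
          contradiction (subst (_∈ X) (trans (sym ≡e) (trans entry≡ ≡y)) ∈X) y∉X
        same-exit (inj₂ (_ , ≡e)) (inj₂ (_ , ≡e′)) = trans (sym ≡e) (trans entry≡ ≡e′)

      head-route-disjoint : ∀ i i′ {u} → u ∈ˡ start (P i) ∷ PrefixTo.rest (to-X₁ i) →
                            u ∉ˡ Continuation.route (continue i′)
      head-route-disjoint i i′ u∈ u∈′ with head-inside i u∈ | Continuation.∉R∪X (continue i′) u∈′
      ... | inj₁ u∈R | u∉R , _ = u∉R u∈R
      ... | inj₂ u∈X | _ , u∉X = u∉X u∈X

      spliced : Fin k → EPath E⁺
      spliced i = epath (start (P i)) (rest ++ route) (++-walk (map-walk adj-∷⁺ walk) C.walk)
                        (Unique.++⁺ unique C.unique (λ (u∈ , u∈′) → head-route-disjoint i i u∈ u∈′))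
        where
        open PrefixTo (to-X₁ i)
        module C = Continuation (continue i)
        open C using (route)

      spliced-linkage : ABLinkage E⁺ A B k
      spliced-linkage = record
        { paths    = spliced
        ; disjoint = disjoint
        ; start∈A  = L₁.start∈A
        ; end∈B    = end∈B
        }
        where
        end∈B : ∀ i → end (spliced i) ∈ B
        end∈B i = subst (_∈ B) (sym (last-++ (start (P i)) (PrefixTo.rest (to-X₁ i)) route)) C.end∈B
          where
          module C = Continuation (continue i)
          open C using (route)
        disjoint : ∀ i i′ → i ≢ i′ → ∀ u → u ∈ˡ verts (spliced i) → u ∉ˡ verts (spliced i′)
        disjoint i i′ i≢i′ u u∈ u∈′ with ∈-++⁻ (start (P i) ∷ _) u∈ | ∈-++⁻ (start (P i′) ∷ _) u∈′
        ... | inj₁ a | inj₁ b = L₁.disjoint i i′ i≢i′ u (PrefixTo.⊆path (to-X₁ i) a) (PrefixTo.⊆path (to-X₁ i′) b)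
        ... | inj₁ a | inj₂ b = head-route-disjoint i i′ a b
        ... | inj₂ a | inj₁ b = head-route-disjoint i′ i b a
        ... | inj₂ a | inj₂ b = L₂.disjoint _ _ (i≢i′ ∘ continuation-injective) u
                                  (Continuation.⊆Q (continue i) a) (Continuation.⊆Q (continue i′) b)

    menger-step : (∀ A′ B′ → ABSeparator E A′ B′ k ⊎ ABLinkage E A′ B′ k) →
                  ABSeparator E⁺ A B k ⊎ ABLinkage E⁺ A B k
    menger-step menger with menger A X₁ | menger X₂ B
    ... | inj₁ S₁ | _       = inj₁ (separator-to-X₁ S₁)
    ... | inj₂ _  | inj₁ S₂ = inj₁ (separator-from-X₂ S₂)
    ... | inj₂ L₁ | inj₂ L₂ = inj₂ (Splice.spliced-linkage L₁ L₂)

  menger-edgeless : ∀ A B k → ABSeparator [] A B k ⊎ ABLinkage [] A B k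
  menger-edgeless A B k with ∣ A ∩ B ∣ <? k
  ... | yes small = inj₁ (record
    { R = A ─ B ; X = A ∩ B ; A⊆R∪X = A⊆R∪X ; B∩R≡∅ = λ v∈B v∈R → x∈p─q⇒x∉q v∈R v∈B
    ; closed = λ { (inj₁ ()) ; (inj₂ ()) } ; ∣X∣<k = small })
    where
    A⊆R∪X : ∀ {v} → v ∈ A → v ∈ A ─ B ⊎ v ∈ A ∩ B
    A⊆R∪X {v} v∈A with v ∈? B
    ... | yes v∈B = inj₂ (x∈p∩q⁺ (v∈A , v∈B))
    ... | no  v∉B = inj₁ (x∈p∧x∉q⇒x∈p─q v∈A v∉B)
  ... | no large with enumerate≤ (A ∩ B) (≮⇒≥ large)
  ... | g , g-inj , g∈A∩B = inj₂ (record
    { paths    = λ i → epath (g i) [] nil ([] ∷ [])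
    ; disjoint = λ { i j i≢j v (here refl) (here eq) → i≢j (g-inj eq) }
    ; start∈A  = proj₁ ∘ x∈p∩q⁻ A B ∘ g∈A∩B
    ; end∈B    = proj₂ ∘ x∈p∩q⁻ A B ∘ g∈A∩B
    })

  module _ {E : Edges} {A B : Subset N} {k : ℕ} (S : ABSeparator E A B k) where
    open ABSeparator S

    Crossing : Vertex → Vertex → Set
    Crossing a b = a ∈ R × b ∉ R × b ∉ X

    crossing? : ∀ a b → Dec (Crossing a b)
    crossing? a b with a ∈? R | b ∈? R | b ∈? X
    ... | no  a∉R | _       | _       = no λ (a∈R , _) → a∉R a∈R
    ... | yes _   | yes b∈R | _       = no λ (_ , b∉R , _) → b∉R b∈R
    ... | yes _   | no  _   | yes b∈X = no λ (_ , _ , b∉X) → b∉X b∈X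
    ... | yes a∈R | no  b∉R | no  b∉X = yes (a∈R , b∉R , b∉X)

    add-non-crossing : ∀ {a b} → ¬ Crossing a b → ¬ Crossing b a → ABSeparator ((a , b) ∷ E) A B k
    add-non-crossing {a} {b} ¬ab ¬ba = record
      { R = R ; X = X ; A⊆R∪X = A⊆R∪X ; B∩R≡∅ = B∩R≡∅ ; closed = closed′ ; ∣X∣<k = ∣X∣<k }
      where
      leave : ∀ {u v} → ¬ Crossing u v → u ∈ R → v ∈ R ⊎ v ∈ X
      leave {v = v} ¬uv u∈R with v ∈? R | v ∈? X
      ... | yes v∈R | _       = inj₁ v∈R
      ... | no  _   | yes v∈X = inj₂ v∈X
      ... | no  v∉R | no  v∉X = contradiction (u∈R , v∉R , v∉X) ¬uv
      closed′ : Closed ((a , b) ∷ E) R X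
      closed′ e with adj-∷⁻ e
      ... | inj₁ (refl , refl)        = leave ¬ab
      ... | inj₂ (inj₁ (refl , refl)) = leave ¬ba
      ... | inj₂ (inj₂ e′)            = closed e′

  menger : ∀ E A B k → ABSeparator E A B k ⊎ ABLinkage E A B k
  menger []            A B k = menger-edgeless A B k
  menger ((a , b) ∷ E) A B k with menger E A B k
  ... | inj₂ L = inj₂ (map-linkage adj-∷⁺ L)
  ... | inj₁ S with crossing? S a b | crossing? S b a
  ...   | yes (a∈R , b∉R , b∉X) | _ = MengerStep.menger-step S a∈R b∉R b∉X (λ A′ B′ → menger E A′ B′ k)
  ...   | no _ | yes (b∈R , a∉R , a∉X) =
    Sum.map (comap-separator adj-swap) (map-linkage adj-swap)
            (MengerStep.menger-step S b∈R a∉R a∉X (λ A′ B′ → menger E A′ B′ k))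
  ...   | no ¬ab | no ¬ba = inj₁ (add-non-crossing S ¬ab ¬ba)

-- Separations of G

module _ (G : Graph) where

  path-end : ∀ v vs (w : Walk G v vs) (d : Unique (v ∷ vs)) →
             Path.end (record { start = v ; rest = vs ; walk = w ; distinct = d }) ≡ last v vs
  path-end v []       w          d       = refl
  path-end v (u ∷ us) (step e w) (_ ∷ d) = path-end u us w d

  ∈-starts⁺ : ∀ {K} (P : Fin K → Path G) j → Path.start (P j) ∈ starts P
  ∈-starts⁺ P j = x∈⋃⁺ (∈-map⁺ _ (∈-allFin j)) (x∈⁅x⁆ _)

  ∈-starts⁻ : ∀ {K} (P : Fin K → Path G) {v} → v ∈ starts P → ∃ λ j → Path.start (P j) ≡ v
  ∈-starts⁻ {K} P v∈ with x∈⋃⁻ (map (λ j → ⁅ Path.start (P j) ⁆) (allFin K)) v∈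
  ... | p , p∈ , v∈p with ∈-map⁻ _ p∈
  ...   | j , _ , refl = j , sym (x∈⁅y⁆⇒x≡y _ v∈p)

  module _ (R X : Subset (n G)) (closed : ∀ {u v} → adj G u v ≡ true → u ∈ R → v ∈ R ⊎ v ∈ X) where

    private
      R∪X-closed : ∀ {u v} → adj G u v ≡ true → u ∈ R → v ∈ R ∪ X
      R∪X-closed e u∈R = x∈p∪q⁺ (closed e u∈R)

    region-separation : Separation G
    region-separation = record
      { VA = R ∪ X ; VB = ∁ R
      ; EA = λ u v → (does (u ∈? R) ∨ does (v ∈? R)) ∧ adj G u v
      ; EB = λ u v → not (does (u ∈? R) ∨ does (v ∈? R)) ∧ adj G u v
      ; EA-sym = λ u v → cong₂ _∧_ (∨-comm (does (u ∈? R)) _) (adj-sym G u v)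
      ; EB-sym = λ u v → cong₂ _∧_ (cong not (∨-comm (does (u ∈? R)) _)) (adj-sym G u v)
      ; EA-sub = EA-sub ; EB-sub = EB-sub ; cover-V = cover-V ; cover-E = cover-E ; disj-E = disj-E
      }
      where
      EA-sub : ∀ u v → (does (u ∈? R) ∨ does (v ∈? R)) ∧ adj G u v ≡ true →
               adj G u v ≡ true × u ∈ R ∪ X × v ∈ R ∪ X
      EA-sub u v e with u ∈? R | v ∈? R
      ... | yes u∈R | _       = e , x∈p∪q⁺ (inj₁ u∈R) , R∪X-closed e u∈R
      ... | no  _   | yes v∈R = e , R∪X-closed (trans (adj-sym G v u) e) v∈R , x∈p∪q⁺ (inj₁ v∈R)
      EB-sub : ∀ u v → not (does (u ∈? R) ∨ does (v ∈? R)) ∧ adj G u v ≡ true →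
               adj G u v ≡ true × u ∈ ∁ R × v ∈ ∁ R
      EB-sub u v e with u ∈? R | v ∈? R
      ... | no u∉R | no v∉R = e , x∉p⇒x∈∁p u∉R , x∉p⇒x∈∁p v∉R
      cover-V : ∀ v → v ∈ R ∪ X ⊎ v ∈ ∁ R
      cover-V v with v ∈? R
      ... | yes v∈R = inj₁ (x∈p∪q⁺ (inj₁ v∈R))
      ... | no  v∉R = inj₂ (x∉p⇒x∈∁p v∉R)
      cover-E : ∀ u v → adj G u v ≡ true → (does (u ∈? R) ∨ does (v ∈? R)) ∧ adj G u v ≡ true
                                        ⊎ not (does (u ∈? R) ∨ does (v ∈? R)) ∧ adj G u v ≡ true
      cover-E u v e with u ∈? R | v ∈? R
      ... | yes _ | _     = inj₁ e
      ... | no  _ | yes _ = inj₁ e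
      ... | no  _ | no  _ = inj₂ e
      disj-E : ∀ u v → (does (u ∈? R) ∨ does (v ∈? R)) ∧ adj G u v ≡ true
                     → not (does (u ∈? R) ∨ does (v ∈? R)) ∧ adj G u v ≡ false
      disj-E u v e with u ∈? R | v ∈? R
      ... | yes _ | _     = refl
      ... | no  _ | yes _ = refl

    region-order : order region-separation ≤ ∣ X ∣
    region-order = p⊆q⇒∣p∣≤∣q∣ R∪X∩∁R⊆X
      where
      R∪X∩∁R⊆X : (R ∪ X) ∩ ∁ R ⊆ X
      R∪X∩∁R⊆X v∈ with x∈p∩q⁻ _ _ v∈
      ... | v∈R∪X , v∈∁R with x∈p∪q⁻ _ _ v∈R∪X
      ...   | inj₁ v∈R = contradiction v∈R (x∈∁p⇒x∉p v∈∁R)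
      ...   | inj₂ v∈X = v∈X

split-budget : ∀ {o c} k ℓ → o + k * c < k * ℓ → o < k * (ℓ ∸ c) × c ≤ ℓ ∸ 1
split-budget {o} {c} k ℓ lt =
    subst (o <_) (sym (*-distribˡ-∸ k ℓ c)) (m+n≤o⇒m≤o∸n (suc o) lt)
  , subst (c ≤_) (pred[m∸n]≡m∸[1+n] ℓ 0) (<⇒≤pred (*-cancelˡ-< k c ℓ (≤-<-trans (m≤n+m (k * c) o) lt)))

SmallSeparation : (G : Graph) → Roots G → Subset (n G) → ℕ → ℕ → Set
SmallSeparation G Z Y k ℓ =
  Σ (Separation G) λ S →
    (order S < k * (ℓ ∸ ‖_∖_‖ {G} Z (Separation.VA S))) ×
    (Y ⊆ Separation.VB S) ×
    (‖_∖_‖ {G} Z (Separation.VA S) ≤ ℓ ∸ 1)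

-- The auxiliary graph

module Auxiliary (G : Graph) (Z : Roots G) (Y : Subset (n G)) (k : ℕ) where

  m N⁺ : ℕ
  m = length Z
  N⁺ = n G + m * k

  open Menger N⁺

  vertex : V G → Fin N⁺
  vertex v = v ↑ˡ (m * k)

  copy : Fin m → Fin k → Fin N⁺
  copy i c = n G ↑ʳ combine i c

  Kind : Set
  Kind = V G ⊎ (Fin m × Fin k)

  kind : Fin N⁺ → Kind
  kind w = Sum.map₂ (remQuot k) (splitAt (n G) w)

  kind-vertex : ∀ v → kind (vertex v) ≡ inj₁ v
  kind-vertex v rewrite splitAt-↑ˡ (n G) v (m * k) = refl

  kind-copy : ∀ i c → kind (copy i c) ≡ inj₂ (i , c)
  kind-copy i c rewrite splitAt-↑ʳ (n G) (m * k) (combine i c) | remQuot-combine {m} {k} i c = refl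

  classify : ∀ w → (∃ λ v → vertex v ≡ w) ⊎ (∃₂ λ i c → copy i c ≡ w)
  classify w with splitAt (n G) w in split
  ... | inj₁ v = inj₁ (v , splitAt⁻¹-↑ˡ split)
  ... | inj₂ s = inj₂ (_ , _ , trans (cong (n G ↑ʳ_) (combine-remQuot {m} k s)) (splitAt⁻¹-↑ʳ split))

  linked : Kind → Kind → Bool
  linked (inj₁ u)       (inj₁ v) = adj G u v
  linked (inj₂ (i , _)) (inj₁ v) = lookup (List.lookup Z i) v
  linked _              (inj₂ _) = false

  linked? : (e : Fin N⁺ × Fin N⁺) → Dec (linked (kind (proj₁ e)) (kind (proj₂ e)) ≡ true)
  linked? (a , b) = linked (kind a) (kind b) ≟ᵇ true

  E : Edges
  E = filter linked? (cartesianProduct (allFin N⁺) (allFin N⁺))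

  adj⁺ : ∀ {a b} → linked (kind a) (kind b) ≡ true → Adj E a b
  adj⁺ l = inj₁ (∈-filter⁺ linked? (∈-cartesianProduct⁺ (∈-allFin _) (∈-allFin _)) l)

  linked⁺ : ∀ {a b} → (a , b) ∈ˡ E → linked (kind a) (kind b) ≡ true
  linked⁺ e = proj₂ (∈-filter⁻ linked? {xs = cartesianProduct (allFin N⁺) (allFin N⁺)} e)

  linked-kinds : ∀ {a b p q} → kind a ≡ p → kind b ≡ q → linked p q ≡ true → linked (kind a) (kind b) ≡ true
  linked-kinds refl refl l = l

  vertex-adj : ∀ {u v} → adj G u v ≡ true → Adj E (vertex u) (vertex v)
  vertex-adj {u} {v} e = adj⁺ (linked-kinds (kind-vertex u) (kind-vertex v) e)

  copy-adj : ∀ {i c v} → v ∈ List.lookup Z i → Adj E (copy i c) (vertex v)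
  copy-adj {i} {c} {v} v∈ = adj⁺ (linked-kinds (kind-copy i c) (kind-vertex v) ([]=⇒lookup v∈))

  adj-vertex : ∀ {u v} → Adj E (vertex u) (vertex v) → adj G u v ≡ true
  adj-vertex {u} {v} (inj₁ e) = subst₂ (λ p q → linked p q ≡ true) (kind-vertex u) (kind-vertex v) (linked⁺ e)
  adj-vertex {u} {v} (inj₂ e) = trans (adj-sym G u v)
    (subst₂ (λ p q → linked p q ≡ true) (kind-vertex v) (kind-vertex u) (linked⁺ e))

  adj-copy : ∀ {i c v} → Adj E (copy i c) (vertex v) → v ∈ List.lookup Z i
  adj-copy {i} {c} {v} (inj₁ e) =
    lookup⇒[]= v _ (subst₂ (λ p q → linked p q ≡ true) (kind-copy i c) (kind-vertex v) (linked⁺ e))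
  adj-copy {i} {c} {v} (inj₂ e) =
    contradiction (subst₂ (λ p q → linked p q ≡ true) (kind-vertex v) (kind-copy i c) (linked⁺ e)) λ ()

  is-copy : Kind → Bool
  is-copy (inj₁ _) = false
  is-copy (inj₂ _) = true

  in-Y : Kind → Bool
  in-Y (inj₁ v) = lookup Y v
  in-Y (inj₂ _) = false

  Sources Targets : Subset N⁺
  Sources = tabulate (is-copy ∘ kind)
  Targets = tabulate (in-Y ∘ kind)

  copy∈Sources : ∀ i c → copy i c ∈ Sources
  copy∈Sources i c = ∈-tabulate⁺ (cong is-copy (kind-copy i c))

  vertex∉Sources : ∀ v → vertex v ∉ Sources
  vertex∉Sources v v∈ = contradiction (trans (sym (∈-tabulate⁻ v∈)) (cong is-copy (kind-vertex v))) λ ()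

  copy∉Targets : ∀ i c → copy i c ∉ Targets
  copy∉Targets i c c∈ = contradiction (trans (sym (∈-tabulate⁻ c∈)) (cong in-Y (kind-copy i c))) λ ()

  vertex∈Targets⁺ : ∀ {v} → v ∈ Y → vertex v ∈ Targets
  vertex∈Targets⁺ {v} v∈Y = ∈-tabulate⁺ (trans (cong in-Y (kind-vertex v)) ([]=⇒lookup v∈Y))

  vertex∈Targets⁻ : ∀ {v} → vertex v ∈ Targets → v ∈ Y
  vertex∈Targets⁻ {v} v∈ = lookup⇒[]= v Y (trans (sym (cong in-Y (kind-vertex v))) (∈-tabulate⁻ v∈))

  module FromSeparator {ℓ : ℕ} (S : ABSeparator E Sources Targets (k * ℓ)) where
    open ABSeparator S

    Rᴳ Xᴳ : Subset (n G)
    Rᴳ = pullback vertex R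
    Xᴳ = pullback vertex X

    closed-in-R∪X : ∀ {w v} → Adj E w (vertex v) → w ∈ R → v ∈ Rᴳ ⊎ v ∈ Xᴳ
    closed-in-R∪X e w∈R = Sum.map ∈-pullback⁺ ∈-pullback⁺ (closed e w∈R)

    closedᴳ : ∀ {u v} → adj G u v ≡ true → u ∈ Rᴳ → v ∈ Rᴳ ⊎ v ∈ Xᴳ
    closedᴳ e u∈ = closed-in-R∪X (vertex-adj e) (∈-pullback⁻ u∈)

    separation : Separation G
    separation = region-separation G Rᴳ Xᴳ closedᴳ

    Y⊆VB : Y ⊆ ∁ Rᴳ
    Y⊆VB v∈Y = x∉p⇒x∈∁p (λ v∈R → B∩R≡∅ (vertex∈Targets⁺ v∈Y) (∈-pullback⁻ v∈R))

    unlinked⇒copies∈X : ∀ i c → ¬ (List.lookup Z i ⊆ Rᴳ ∪ Xᴳ) → copy i c ∈ X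
    unlinked⇒copies∈X i c Zi⊈A with A⊆R∪X (copy∈Sources i c)
    ... | inj₂ copy∈X = copy∈X
    ... | inj₁ copy∈R = contradiction (λ {v} v∈Zi → x∈p∪q⁺ (closed-in-R∪X (copy-adj v∈Zi) copy∈R)) Zi⊈A

    order+k*unlinked≤∣X∣ : order separation + k * ‖_∖_‖ {G} Z (Rᴳ ∪ Xᴳ) ≤ ∣ X ∣
    order+k*unlinked≤∣X∣ = begin
      order separation + k * ‖_∖_‖ {G} Z (Rᴳ ∪ Xᴳ)
        ≤⟨ +-mono-≤ (region-order G Rᴳ Xᴳ closedᴳ)
                    (full-blocks≤∣p∣ _ Z (pullback (n G ↑ʳ_) X) (λ i c → ∈-pullback⁺ ∘ unlinked⇒copies∈X i c)) ⟩
      ∣ Xᴳ ∣ + ∣ pullback (n G ↑ʳ_) X ∣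
        ≡⟨ ∣p∣≡∣↑ˡ∣+∣↑ʳ∣ (n G) (m * k) X ⟨
      ∣ X ∣ ∎
      where open ≤-Reasoning

    small-separation : SmallSeparation G Z Y k ℓ
    small-separation with split-budget k ℓ (≤-<-trans order+k*unlinked≤∣X∣ ∣X∣<k)
    ... | order<k*[ℓ∸unlinked] , unlinked≤ℓ∸1 = separation , order<k*[ℓ∸unlinked] , Y⊆VB , unlinked≤ℓ∸1

  non-source⇒vertex : ∀ {w} → w ∉ Sources → ∃ λ v → vertex v ≡ w
  non-source⇒vertex {w} w∉ with classify w
  ... | inj₁ is-vertex      = is-vertex
  ... | inj₂ (i , c , refl) = contradiction (copy∈Sources i c) w∉

  source⇒copy : ∀ {w} → w ∈ Sources → ∃₂ λ i c → copy i c ≡ w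
  source⇒copy {w} w∈ with classify w
  ... | inj₁ (v , refl) = contradiction w∈ (vertex∉Sources v)
  ... | inj₂ is-copy    = is-copy

  source∉Targets : ∀ {w} → w ∈ Sources → w ∉ Targets
  source∉Targets w∈ with source⇒copy w∈
  ... | i , c , refl = copy∉Targets i c

  lower-walk : ∀ {w ws} → EWalk E w ws → (∀ {u} → u ∈ˡ w ∷ ws → u ∉ Sources) →
               ∃₂ λ v vs → Walk G v vs × vertex v ≡ w × map vertex vs ≡ ws
  lower-walk nil ∉S with non-source⇒vertex (∉S (here refl))
  ... | v , refl = v , [] , single v , refl , refl
  lower-walk (cons e w) ∉S with non-source⇒vertex (∉S (here refl)) | lower-walk w (∉S ∘ there)
  ... | v , refl | u , us , w′ , refl , refl = v , u ∷ us , step (adj-vertex e) w′ , refl , refl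

  module FromLinkage {K : ℕ} (L : ABLinkage E Sources Targets K) where
    open ABLinkage L

    record RootedPath (j : Fin K) : Set where
      field
        root       : Fin m
        label      : Fin k
        copy∈      : copy root label ∈ˡ EPath.verts (paths j)
        path       : Path G
        start∈root : Path.start path ∈ List.lookup Z root
        end∈Y      : Path.end path ∈ Y
        lifts      : ∀ {u} → u ∈ˡ Path.verts path → vertex u ∈ˡ EPath.verts (paths j)

    lower : ∀ j → RootedPath j
    lower j with suffix-from Sources (EPath.walk (paths j)) (EPath.unique (paths j)) (start∈A j)
    ... | suffix a [] _ _ a∈S _ same-end _ =
      contradiction (subst (_∈ Targets) (sym same-end) (end∈B j)) (source∉Targets a∈S)
    ... | suffix a (b ∷ bs) (cons e w) (_ ∷ unique) a∈S rest∉S same-end ⊆path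
      with source⇒copy a∈S | lower-walk w rest∉S
    ...   | i , c , refl | v , vs , walk , refl , refl = record
      { root       = i
      ; label      = c
      ; copy∈      = ⊆path (here refl)
      ; path       = record { start = v ; rest = vs ; walk = walk ; distinct = Unique.map⁻ unique }
      ; start∈root = adj-copy e
      ; end∈Y      = subst (_∈ Y) (sym (path-end G v vs walk (Unique.map⁻ unique))) (vertex∈Targets⁻ end∈T)
      ; lifts      = ⊆path ∘ there ∘ ∈-map⁺ vertex
      }
      where
      end∈T : vertex (last v vs) ∈ Targets
      end∈T = subst (_∈ Targets) (trans (sym same-end) (sym (last-map vertex v vs))) (end∈B j)

    P : Fin K → Path G
    P = RootedPath.path ∘ lower

    root : Fin K → Fin m
    root = RootedPath.root ∘ lower

    label : Fin K → Fin k
    label = RootedPath.label ∘ lower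

    start : Fin K → V G
    start = Path.start ∘ P

    start-injective : Injective _≡_ _≡_ start
    start-injective eq =
      on-paths-injective (vertex ∘ start) (λ j → RootedPath.lifts (lower j) (here refl)) (cong vertex eq)

    copy-injective : ∀ {j j′} → root j ≡ root j′ → label j ≡ label j′ → j ≡ j′
    copy-injective r l =
      on-paths-injective (λ j → copy (root j) (label j)) (RootedPath.copy∈ ∘ lower) (cong₂ copy r l)

    used? : Decidable λ i → ∃ λ j → root j ≡ i
    used? i = any? (λ j → root j ≟ᶠ i)

    class? : ∀ i → Decidable λ v → ∃ λ j → root j ≡ i × start j ≡ v
    class? i v = any? (λ j → (root j ≟ᶠ i) ×-dec (start j ≟ᶠ v))

    used : Subset m
    used = subsetOf used?

    class : Fin m → Subset (n G)
    class i = subsetOf (class? i)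

    start∈class : ∀ j → start j ∈ class (root j)
    start∈class j = ∈-subsetOf⁺ (class? _) (j , refl , refl)

    class⁻ : ∀ {i v} → v ∈ class i → ∃ λ j → root j ≡ i × start j ≡ v
    class⁻ = ∈-subsetOf⁻ (class? _)

    partition : AdmitsPartition {G} Z k (starts P)
    partition with enumerate used
    ... | γ , γ-injective , γ∈used =
      ∣ used ∣ , class ∘ γ , γ , nonempty , disjoint-classes , covered , ⊆starts , γ-injective , ∣class∣≤k , ⊆Z
      where
      nonempty : ∀ t → Nonempty (class (γ t))
      nonempty t with ∈-subsetOf⁻ used? (γ∈used t)
      ... | j , root≡ = start j , subst (λ i → start j ∈ class i) root≡ (start∈class j)
      disjoint-classes : ∀ t t′ → t ≢ t′ → Empty (class (γ t) ∩ class (γ t′))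
      disjoint-classes t t′ t≢t′ (v , v∈) with x∈p∩q⁻ _ _ v∈
      ... | v∈t , v∈t′ with class⁻ v∈t | class⁻ v∈t′
      ...   | j , root≡ , start≡ | j′ , root≡′ , start≡′ with start-injective (trans start≡ (sym start≡′))
      ...     | refl = t≢t′ (γ-injective (trans (sym root≡) root≡′))
      covered : ∀ v → v ∈ starts P → ∃ λ t → v ∈ class (γ t)
      covered v v∈ with ∈-starts⁻ G P v∈
      ... | j , refl with enumeration-surjective (γ , γ-injective , γ∈used) ≤-refl (∈-subsetOf⁺ used? (j , refl))
      ...   | t , γt≡ = t , subst (λ i → start j ∈ class i) (sym γt≡) (start∈class j)
      ⊆starts : ∀ t → class (γ t) ⊆ starts P
      ⊆starts t v∈ with class⁻ v∈
      ... | j , _ , refl = ∈-starts⁺ G P j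
      ∣class∣≤k : ∀ t → ∣ class (γ t) ∣ ≤ k
      ∣class∣≤k t = ∣p∣≤k-by-labels (label ∘ proj₁ ∘ class⁻) same-label⇒same
        where
        same-label⇒same : ∀ {v w} (v∈ : v ∈ class (γ t)) (w∈ : w ∈ class (γ t)) →
                          label (proj₁ (class⁻ v∈)) ≡ label (proj₁ (class⁻ w∈)) → v ≡ w
        same-label⇒same v∈ w∈ label≡ with class⁻ v∈ | class⁻ w∈
        ... | j , root≡ , refl | j′ , root≡′ , refl = cong start (copy-injective (trans root≡ (sym root≡′)) label≡)
      ⊆Z : ∀ t → class (γ t) ⊆ List.lookup Z (γ t)
      ⊆Z t v∈ with class⁻ v∈
      ... | j , root≡ , start≡ =
        subst₂ (λ i v → v ∈ List.lookup Z i) root≡ start≡ (RootedPath.start∈root (lower j))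

    linkage : Linkage G Z Y k K
    linkage = record
      { paths     = P
      ; disjoint  = λ j j′ j≢j′ u u∈ u∈′ → ABLinkage.disjoint L j j′ j≢j′ (vertex u)
                      (RootedPath.lifts (lower j) u∈) (RootedPath.lifts (lower j′) u∈′)
      ; from-Z    = λ j → x∈⋃⁺ (∈-lookup {xs = Z} (root j)) (RootedPath.start∈root (lower j))
      ; to-Y      = RootedPath.end∈Y ∘ lower
      ; partition = partition
      }

proposition3p2 : (k ℓ : ℕ) → 1 ≤ k → 1 ≤ ℓ →
    (G : Graph) (Z : Roots G) (Y : Subset (n G)) →
    (Σ (Separation G) λ S →
        (order S < k * (ℓ ∸ ‖_∖_‖ {G} Z (Separation.VA S))) ×
        (Y ⊆ Separation.VB S) ×
        (‖_∖_‖ {G} Z (Separation.VA S) ≤ ℓ ∸ 1))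
    ⊎ Linkage G Z Y k (k * ℓ)
proposition3p2 k ℓ _ _ G Z Y =
  Sum.map FromSeparator.small-separation FromLinkage.linkage (Menger.menger N⁺ E Sources Targets (k * ℓ))
  where open Auxiliary G Z Y k
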